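{- Let $\mathcal{C}$ be the set of all mazes $(M,o,d)$ where $M$ is a board obtained from $\mathbb{Z}^2$ by removing an arbitrary set of horizontal edges and no vertical edges, and $o,d$ are vertices in the same connected component of $M$. There exists an algorithm that solves $\mathcal{C}$.
   Context: A board is a spanning subgraph $M$ of the graph $\mathbb{Z}^2$; each edge is traversable in both directions, and the directed edge from $(x,y)$ to $(x,y+1)$, $(x,y-1)$, $(x+1,y)$, $(x-1,y)$ has colour $N$, $S$, $E$, $W$ respectively. A maze is a triple $(M,o,d)$ with $M$ a board and $o$ (origin), $d$ (destination) vertices in the same connected component of $M$. An algorithm is a finite or infinite sequence of instructions from $\{N,S,E,W\}$. A robot at vertex $v$ executing instruction $I$ moves along the edge of colour $I$ leaving $v$ if it is present in $M$, and otherwise stays at $v$. The robot starts at $o$ and executes the instructions in order; the algorithm solves the maze if the robot visits $d$ at some time, and solves a set of mazes if it solves each of them. Horizontal edges are those of colours $E,W$, vertical edges those of colours $N,S$. -}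

module Defs where

open import Data.Bool using (Bool; true; false; if_then_else_)
open import Data.Integer using (ℤ; _+_; _-_; 1ℤ)
open import Data.Nat using (ℕ; zero; suc)
open import Data.Product using (_×_; _,_; ∃)
open import Relation.Binary.PropositionalEquality using (_≡_)

Vertex : Set
Vertex = ℤ × ℤ

data Dir : Set where
  N S E W : Dir

-- A board (spanning subgraph of ℤ²), given by which edges are present.
--   hor x y : the edge between (x,y) and (x+1,y) is present
--   ver x y : the edge between (x,y) and (x,y+1) is present
record Board : Set where
  field
    hor : ℤ → ℤ → Bool
    ver : ℤ → ℤ → Bool
open Board public

step : Board → Vertex → Dir → Vertex
step M (x , y) N = if ver M x y then (x , y + 1ℤ) else (x , y)
step M (x , y) S = if ver M x (y - 1ℤ) then (x , y - 1ℤ) else (x , y)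
step M (x , y) E = if hor M x y then (x + 1ℤ , y) else (x , y)
step M (x , y) W = if hor M (x - 1ℤ) y then (x - 1ℤ , y) else (x , y)

Algorithm : Set
Algorithm = ℕ → Dir

run : Algorithm → Board → Vertex → ℕ → Vertex
run A M o zero = o
run A M o (suc n) = step M (run A M o n) (A n)

data Adj (M : Board) : Vertex → Vertex → Set where
  adjE : ∀ x y → hor M x y ≡ true → Adj M (x , y) (x + 1ℤ , y)
  adjW : ∀ x y → hor M x y ≡ true → Adj M (x + 1ℤ , y) (x , y)
  adjN : ∀ x y → ver M x y ≡ true → Adj M (x , y) (x , y + 1ℤ)
  adjS : ∀ x y → ver M x y ≡ true → Adj M (x , y + 1ℤ) (x , y)

data Connected (M : Board) : Vertex → Vertex → Set where
  here : ∀ {v} → Connected M v v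
  there : ∀ {u v w} → Adj M u v → Connected M v w → Connected M u w

record Maze : Set where
  field
    board : Board
    origin : Vertex
    dest : Vertex
    conn : Connected board origin dest
open Maze public

Solves : Algorithm → Maze → Set
Solves A m = ∃ λ n → run A (board m) (origin m) n ≡ dest m

InC : Maze → Set
InC m = ∀ x y → ver (board m) x y ≡ true

-- Since all vertical edges are present, the robot can always return to the
-- row y₀ of the origin, so only horizontal progress matters. Call column x
-- bridged in the window K if some edge from column x to x + 1 lies in one of
-- the rows y₀ - K, …, y₀ + K. In block K the robot, on row y₀, repeatedly tries
-- to step east from every row of the window, returning to row y₀ and sweeping
-- the window of its column after each try; then it does the mirror image
-- westward. It only ever crosses bridges, so every boundary between the origin
-- and the robot stays bridged, and it crosses every bridge it meets, sweeping
-- each column it enters. For K large enough the destination row lies in the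
-- window and all boundaries between origin and destination are bridged, since
-- a path between them crosses each one; the robot has moved at most once per
-- instruction so far, so a block has enough rounds to reach the destination column.
module Submission where

open import Defs
open import Data.Bool using (true; false)
open import Data.Empty using (⊥-elim)
open import Data.Integer using (ℤ; +_; -[1+_]; _+_; _-_; -_; 1ℤ; -1ℤ; ∣_∣; _≤_; _<_; +≤+; -≤+)
import Data.Integer.Properties as ℤP
open import Data.Integer.Tactic.RingSolver using (solve-∀)
open import Data.List using (List; []; _∷_; _++_; length; foldl; map; replicate; concat)
open import Data.List.Properties using (foldl-++; ++-assoc; ++-identityʳ; length-++; length-++-≤ˡ; length-++-≤ʳ)
open import Data.Nat as ℕ using (ℕ; zero; suc; z≤n; s≤s)
import Data.Nat.Properties as ℕP
open import Data.Product using (Σ; ∃-syntax; _×_; _,_; proj₁; proj₂)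
open import Data.Sum using (_⊎_; inj₁; inj₂)
open import Relation.Nullary using (yes; no)
open import Relation.Binary.PropositionalEquality using (_≡_; refl; sym; trans; cong; subst; subst₂; cong₂)

i<i+1 : ∀ i → i < i + 1ℤ
i<i+1 i = subst (i <_) (ℤP.+-comm 1ℤ i) (ℤP.suc[i]≤j⇒i<j ℤP.≤-refl)

i<j⇒i+1≤j : ∀ {i j} → i < j → i + 1ℤ ≤ j
i<j⇒i+1≤j {i} i<j = subst (_≤ _) (ℤP.+-comm 1ℤ i) (ℤP.i<j⇒suc[i]≤j i<j)

i+1≤j⇒i<j : ∀ {i j} → i + 1ℤ ≤ j → i < j
i+1≤j⇒i<j {i} i+1≤j = ℤP.suc[i]≤j⇒i<j (subst (_≤ _) (ℤP.+-comm i 1ℤ) i+1≤j)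

i<j+1⇒i≤j : ∀ {i j} → i < j + 1ℤ → i ≤ j
i<j+1⇒i≤j {i} {j} i<j+1 = subst (i ≤_) (pred-+1 j) (ℤP.i<j⇒i≤pred[j] i<j+1)
  where
  pred-+1 : ∀ j → -1ℤ + (j + 1ℤ) ≡ j
  pred-+1 = solve-∀

i<j⇒i≤j-1 : ∀ {i j} → i < j → i ≤ j - 1ℤ
i<j⇒i≤j-1 {i} {j} i<j = i<j+1⇒i≤j (subst (i <_) (-1+1 j) i<j)
  where
  -1+1 : ∀ j → j ≡ (j - 1ℤ) + 1ℤ
  -1+1 = solve-∀

i-1<i : ∀ i → i - 1ℤ < i
i-1<i i = i+1≤j⇒i<j (ℤP.≤-reflexive (-1+1 i))
  where
  -1+1 : ∀ i → (i - 1ℤ) + 1ℤ ≡ i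
  -1+1 = solve-∀

-- Columns and the boundaries between them

-- x lies between columns a and c when the boundary from column x to x + 1
-- is crossed on the way from a to c.
Between : ℤ → ℤ → ℤ → Set
Between a c x = (a ≤ x × x < c) ⊎ (c ≤ x × x < a)

AllBetween : (ℤ → Set) → ℤ → ℤ → Set
AllBetween P a c = ∀ x → Between a c x → P x

module _ {P : ℤ → Set} where

  allBetween-refl : ∀ a → AllBetween P a a
  allBetween-refl a x (inj₁ (a≤x , x<a)) = ⊥-elim (ℤP.<⇒≱ x<a a≤x)
  allBetween-refl a x (inj₂ (a≤x , x<a)) = ⊥-elim (ℤP.<⇒≱ x<a a≤x)

  allBetween-sym : ∀ {a c} → AllBetween P a c → AllBetween P c a
  allBetween-sym h x (inj₁ between) = h x (inj₂ between)
  allBetween-sym h x (inj₂ between) = h x (inj₁ between)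

  between-split : ∀ {a c x} b → Between a c x → Between a b x ⊎ Between b c x
  between-split {x = x} b (inj₁ (a≤x , x<c)) with x ℤP.<? b
  ... | yes x<b = inj₁ (inj₁ (a≤x , x<b))
  ... | no x≮b  = inj₂ (inj₁ (ℤP.≮⇒≥ x≮b , x<c))
  between-split {x = x} b (inj₂ (c≤x , x<a)) with x ℤP.<? b
  ... | yes x<b = inj₂ (inj₂ (c≤x , x<b))
  ... | no x≮b  = inj₁ (inj₂ (ℤP.≮⇒≥ x≮b , x<a))

  allBetween-trans : ∀ {a b c} → AllBetween P a b → AllBetween P b c → AllBetween P a c
  allBetween-trans {b = b} ab bc x between with between-split b between
  ... | inj₁ between-ab = ab x between-ab
  ... | inj₂ between-bc = bc x between-bc

  allBetween-adjacent : ∀ {a} → P a → AllBetween P a (a + 1ℤ)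
  allBetween-adjacent {a} pa x (inj₁ (a≤x , x<a+1)) =
    subst P (ℤP.≤-antisym a≤x (i<j+1⇒i≤j x<a+1)) pa
  allBetween-adjacent {a} pa x (inj₂ (a+1≤x , x<a)) =
    ⊥-elim (ℤP.<⇒≱ x<a (ℤP.≤-trans (ℤP.<⇒≤ (i<i+1 a)) a+1≤x))

allBetween-mono : ∀ {P Q : ℤ → Set} {a c} → (∀ {x} → P x → Q x) → AllBetween P a c → AllBetween Q a c
allBetween-mono f h x between = f (h x between)

reflected-bounds : ∀ {a c x} → - a ≤ x → x < - c → c ≤ - x - 1ℤ × - x - 1ℤ < a
reflected-bounds {a} {c} {x} -a≤x x<-c =
  i<j⇒i≤j-1 (subst (_< - x) (ℤP.neg-involutive c) (ℤP.neg-mono-< x<-c)) ,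
  ℤP.<-≤-trans (i-1<i (- x)) (subst (- x ≤_) (ℤP.neg-involutive a) (ℤP.neg-mono-≤ -a≤x))

allBetween-neg : ∀ {P Q : ℤ → Set} {a c} → (∀ {x} → P (- x - 1ℤ) → Q x) →
                 AllBetween P a c → AllBetween Q (- a) (- c)
allBetween-neg f h x (inj₁ (-a≤x , x<-c)) = f (h _ (inj₂ (reflected-bounds -a≤x x<-c)))
allBetween-neg f h x (inj₂ (-c≤x , x<-a)) = f (h _ (inj₁ (reflected-bounds -c≤x x<-a)))

Near : ℤ → ℤ → ℕ → Set
Near a b n = a ≤ b + + n × b ≤ a + + n

near-refl : ∀ a n → Near a a n
near-refl a n = ℤP.i≤i+j a (+ n) , ℤP.i≤i+j a (+ n)

near-sym : ∀ {a b n} → Near a b n → Near b a n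
near-sym (a≤b+n , b≤a+n) = b≤a+n , a≤b+n

near-trans : ∀ {a b c m n} → Near a b m → Near b c n → Near a c (m ℕ.+ n)
near-trans {a} {b} {c} {m} {n} (a≤b+m , b≤a+m) (b≤c+n , c≤b+n) =
  subst (λ k → a ≤ c + + k) (ℕP.+-comm n m) (≤-shift c a≤b+m b≤c+n) , ≤-shift a c≤b+n b≤a+m
  where
  ≤-shift : ∀ {x y k l} z → x ≤ y + + k → y ≤ z + + l → x ≤ z + + (l ℕ.+ k)
  ≤-shift {k = k} {l} z x≤y+k y≤z+l =
    ℤP.≤-trans x≤y+k (ℤP.≤-trans (ℤP.+-monoˡ-≤ (+ k) y≤z+l) (ℤP.≤-reflexive (ℤP.+-assoc z (+ l) (+ k))))

near-mono : ∀ {a b m n} → m ℕ.≤ n → Near a b m → Near a b n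
near-mono {a} {b} m≤n (a≤b+m , b≤a+m) =
  ℤP.≤-trans a≤b+m (ℤP.+-monoʳ-≤ b (+≤+ m≤n)) , ℤP.≤-trans b≤a+m (ℤP.+-monoʳ-≤ a (+≤+ m≤n))

near-exists : ∀ a b → ∃[ n ] Near a b n
near-exists a b = ∣ a - b ∣ , within a b , subst (λ k → b ≤ a + + k) (ℤP.∣i-j∣≡∣j-i∣ b a) (within b a)
  where
  i≤∣i∣ : ∀ i → i ≤ + ∣ i ∣
  i≤∣i∣ (+ n)    = ℤP.≤-refl
  i≤∣i∣ -[1+ n ] = -≤+
  within : ∀ a b → a ≤ b + + ∣ a - b ∣
  within a b = ℤP.≤-trans (ℤP.≤-reflexive (split a b)) (ℤP.+-monoʳ-≤ b (i≤∣i∣ (a - b)))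
    where
    split : ∀ a b → a ≡ b + (a - b)
    split = solve-∀

-- Executing instruction lists

exec : Board → Vertex → List Dir → Vertex
exec M = foldl (step M)

exec-++ : ∀ {M p q r} xs {ys} → exec M p xs ≡ q → exec M q ys ≡ r → exec M p (xs ++ ys) ≡ r
exec-++ {M} {p} xs {ys} refl refl = foldl-++ (step M) p xs ys

data Visits (M : Board) (d : Vertex) : Vertex → List Dir → Set where
  now   : ∀ {ls} → Visits M d d ls
  later : ∀ {p δ ls} → Visits M d (step M p δ) ls → Visits M d p (δ ∷ ls)

visits-++ˡ : ∀ {M d p xs} ys → Visits M d p xs → Visits M d p (xs ++ ys)
visits-++ˡ ys now       = now
visits-++ˡ ys (later v) = later (visits-++ˡ ys v)

visits-++ʳ : ∀ {M d p q} xs {ys} → exec M p xs ≡ q → Visits M d q ys → Visits M d p (xs ++ ys)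
visits-++ʳ []       refl v = v
visits-++ʳ (δ ∷ xs) e    v = later (visits-++ʳ xs e v)

step-east : ∀ {M x y} → hor M x y ≡ true → step M (x , y) E ≡ (x + 1ℤ , y)
step-east edge rewrite edge = refl

step-east-blocked : ∀ {M x y} → hor M x y ≡ false → step M (x , y) E ≡ (x , y)
step-east-blocked no-edge rewrite no-edge = refl

step-near : ∀ M x y δ → Near x (proj₁ (step M (x , y) δ)) 1
step-near M x y N with ver M x y
... | true  = near-refl x 1
... | false = near-refl x 1
step-near M x y S with ver M x (y - 1ℤ)
... | true  = near-refl x 1
... | false = near-refl x 1
step-near M x y E with hor M x y
... | true  = ℤP.<⇒≤ (ℤP.<-trans (i<i+1 x) (i<i+1 (x + 1ℤ))) , ℤP.≤-refl
... | false = near-refl x 1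
step-near M x y W with hor M (x - 1ℤ) y
... | true  = ℤP.≤-reflexive (cancel x) , ℤP.<⇒≤ (ℤP.<-trans (i-1<i x) (i<i+1 x))
  where
  cancel : ∀ x → x ≡ (x - 1ℤ) + 1ℤ
  cancel = solve-∀
... | false = near-refl x 1

exec-near : ∀ M ls p → Near (proj₁ p) (proj₁ (exec M p ls)) (length ls)
exec-near M []       p       = near-refl (proj₁ p) 0
exec-near M (δ ∷ ls) (x , y) = near-trans (step-near M x y δ) (exec-near M ls (step M (x , y) δ))

-- N is a junk default beyond the end of the list.
nth : List Dir → ℕ → Dir
nth []       _       = N
nth (δ ∷ ls) zero    = δ
nth (δ ∷ ls) (suc i) = nth ls i

nth-++ : ∀ xs {ys i} → i ℕ.< length xs → nth (xs ++ ys) i ≡ nth xs i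
nth-++ (δ ∷ xs) {i = zero}  _         = refl
nth-++ (δ ∷ xs) {i = suc i} (s≤s i<n) = nth-++ xs i<n

Agrees : Algorithm → ℕ → List Dir → Set
Agrees A m ls = ∀ i → i ℕ.< length ls → A (m ℕ.+ i) ≡ nth ls i

visits⇒run : ∀ {A M o d p ls} m → Agrees A m ls → run A M o m ≡ p → Visits M d p ls →
             ∃[ n ] run A M o n ≡ d
visits⇒run m agrees at-p now = m , at-p
visits⇒run {A} {M} {ls = δ ∷ ls} m agrees at-p (later v) =
  visits⇒run (suc m) agrees′ (cong₂ (step M) at-p first) v
  where
  first : A m ≡ δ
  first = trans (cong A (sym (ℕP.+-identityʳ m))) (agrees 0 (s≤s z≤n))
  agrees′ : Agrees A (suc m) ls
  agrees′ i i<n = trans (cong A (sym (ℕP.+-suc m i))) (agrees (suc i) (s≤s i<n))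

module Concatenation (next : ℕ → List Dir → List Dir)
                     (next-nonempty : ∀ k xs → 0 ℕ.< length (next k xs)) where

  prefix : ℕ → List Dir
  prefix zero    = []
  prefix (suc k) = prefix k ++ next k (prefix k)

  alg : Algorithm
  alg i = nth (prefix (suc i)) i

  k≤length-prefix : ∀ k → k ℕ.≤ length (prefix k)
  k≤length-prefix zero    = z≤n
  k≤length-prefix (suc k) = begin
    suc k                                         ≡⟨ ℕP.+-comm 1 k ⟩
    k ℕ.+ 1                                       ≤⟨ ℕP.+-mono-≤ (k≤length-prefix k) (next-nonempty k (prefix k)) ⟩
    length (prefix k) ℕ.+ length (next k (prefix k)) ≡⟨ length-++ (prefix k) ⟨
    length (prefix (suc k))                       ∎
    where open ℕP.≤-Reasoning

  prefix-extends : ∀ {k l} → k ℕ.≤′ l → ∃[ rest ] prefix l ≡ prefix k ++ rest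
  prefix-extends ℕ.≤′-refl = [] , sym (++-identityʳ _)
  prefix-extends {k} (ℕ.≤′-step {l} k≤l) with prefix-extends k≤l
  ... | rest , eq = rest ++ next l (prefix l) ,
                    trans (cong (_++ next l (prefix l)) eq) (++-assoc (prefix k) rest _)

  nth-prefix : ∀ {k l i} → k ℕ.≤ l → i ℕ.< length (prefix k) → nth (prefix l) i ≡ nth (prefix k) i
  nth-prefix {k} {i = i} k≤l i<n with prefix-extends (ℕP.≤⇒≤′ k≤l)
  ... | rest , eq = trans (cong (λ ls → nth ls i) eq) (nth-++ (prefix k) i<n)

  alg-agrees : ∀ k → Agrees alg 0 (prefix k)
  alg-agrees k i i<n with ℕP.≤-total k (suc i)
  ... | inj₁ k≤1+i = nth-prefix k≤1+i i<n
  ... | inj₂ 1+i≤k = sym (nth-prefix 1+i≤k (k≤length-prefix (suc i)))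

  prefix-visits⇒solves : ∀ {M o d} k → Visits M d o (prefix k) → ∃[ n ] run alg M o n ≡ d
  prefix-visits⇒solves k = visits⇒run 0 (alg-agrees k) refl

-- Reflection x ↦ -x of the board: the edge from column x to x + 1 of the mirror
-- is the edge from column -x-1 to -x of the original.
mirror : Board → Board
hor (mirror M) x y = hor M (- x - 1ℤ) y
ver (mirror M) x y = ver M (- x) y

reflect : Vertex → Vertex
reflect (x , y) = (- x , y)

flip : Dir → Dir
flip N = N
flip S = S
flip E = W
flip W = E

reflect-involutive : ∀ p → reflect (reflect p) ≡ p
reflect-involutive (x , y) = cong (_, y) (ℤP.neg-involutive x)

-[-x-1]-1≡x : ∀ x → - (- x - 1ℤ) - 1ℤ ≡ x
-[-x-1]-1≡x = solve-∀

x-1≡-[-x+1] : ∀ x → x - 1ℤ ≡ - (- x + 1ℤ)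
x-1≡-[-x+1] = solve-∀

x+1≡-[-x-1] : ∀ x → x + 1ℤ ≡ - (- x - 1ℤ)
x+1≡-[-x-1] = solve-∀

step-mirror : ∀ M p δ → step M p (flip δ) ≡ reflect (step (mirror M) (reflect p) δ)
step-mirror M (x , y) N rewrite ℤP.neg-involutive x with ver M x y
... | true  = sym (reflect-involutive _)
... | false = sym (reflect-involutive _)
step-mirror M (x , y) S rewrite ℤP.neg-involutive x with ver M x (y - 1ℤ)
... | true  = sym (reflect-involutive _)
... | false = sym (reflect-involutive _)
step-mirror M (x , y) E rewrite ℤP.neg-involutive x with hor M (x - 1ℤ) y
... | true  = cong (_, y) (x-1≡-[-x+1] x)
... | false = sym (reflect-involutive _)
step-mirror M (x , y) W rewrite -[-x-1]-1≡x x with hor M x y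
... | true  = cong (_, y) (x+1≡-[-x-1] x)
... | false = sym (reflect-involutive _)

reflect-step : ∀ M p δ → reflect (step M p (flip δ)) ≡ step (mirror M) (reflect p) δ
reflect-step M p δ = trans (cong reflect (step-mirror M p δ)) (reflect-involutive _)

exec-mirror : ∀ M ls p → exec M p (map flip ls) ≡ reflect (exec (mirror M) (reflect p) ls)
exec-mirror M []       p = sym (reflect-involutive p)
exec-mirror M (δ ∷ ls) p =
  trans (exec-mirror M ls _) (cong (λ q → reflect (exec (mirror M) q ls)) (reflect-step M p δ))

visits-mirror : ∀ {M d p ls} → Visits (mirror M) d p ls → Visits M (reflect d) (reflect p) (map flip ls)
visits-mirror now = now
visits-mirror {M} {p = p} (later {δ = δ} v) =
  later (subst (λ q → Visits M _ q _) (sym (unreflect p)) (visits-mirror v))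
  where
  unreflect : ∀ p → step M (reflect p) (flip δ) ≡ reflect (step (mirror M) p δ)
  unreflect p =
    trans (step-mirror M (reflect p) δ) (cong (λ q → reflect (step (mirror M) q δ)) (reflect-involutive p))

-- Windows and bridges

-- Row j, counted from the bottom, of the window of rows y₀ - K, …, y₀ + K.
row : ℤ → ℕ → ℕ → ℤ
row y₀ K j = (y₀ - + K) + + j

record InWindow (y₀ : ℤ) (K : ℕ) (y : ℤ) : Set where
  constructor at-row
  field
    index  : ℕ
    index≤ : index ℕ.≤ K ℕ.+ K
    row≡   : row y₀ K index ≡ y

record Bridge (M : Board) (y₀ : ℤ) (K : ℕ) (x : ℤ) : Set where
  constructor bridge
  field
    {y}      : ℤ
    inWindow : InWindow y₀ K y
    edge     : hor M x y ≡ true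

row-suc : ∀ y₀ k j → (y₀ - (1ℤ + k)) + (1ℤ + j) ≡ (y₀ - k) + j
row-suc = solve-∀

inWindow-suc : ∀ {y₀ K y} → InWindow y₀ K y → InWindow y₀ (suc K) y
inWindow-suc {y₀} {K} (at-row j j≤2K eq) =
  at-row (suc j) (s≤s (ℕP.≤-trans j≤2K (ℕP.+-monoʳ-≤ K (ℕP.n≤1+n K)))) (trans (row-suc y₀ (+ K) (+ j)) eq)

inWindow-mono : ∀ {y₀ K K′ y} → K ℕ.≤ K′ → InWindow y₀ K y → InWindow y₀ K′ y
inWindow-mono K≤K′ = go (ℕP.≤⇒≤′ K≤K′)
  where
  go : ∀ {y₀ K K′ y} → K ℕ.≤′ K′ → InWindow y₀ K y → InWindow y₀ K′ y
  go ℕ.≤′-refl        w = w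
  go (ℕ.≤′-step K≤K′) w = inWindow-suc (go K≤K′ w)

inWindow-exists : ∀ y₀ y → ∃[ K ] InWindow y₀ K y
inWindow-exists y₀ y with y - y₀ in eq
... | + n      =
  n , at-row (n ℕ.+ n) ℕP.≤-refl (trans (above y₀ (+ n)) (trans (cong (λ z → y₀ + z) (sym eq)) (sym (split y y₀))))
  where
  above : ∀ y₀ k → (y₀ - k) + (k + k) ≡ y₀ + k
  above = solve-∀
  split : ∀ y y₀ → y ≡ y₀ + (y - y₀)
  split = solve-∀
... | -[1+ n ] =
  suc n , at-row 0 z≤n (trans (ℤP.+-identityʳ _) (trans (cong (λ z → y₀ + z) (sym eq)) (sym (split y y₀))))
  where
  split : ∀ y y₀ → y ≡ y₀ + (y - y₀)
  split = solve-∀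

bridged-mono : ∀ {M y₀ K K′ a c} → K ℕ.≤ K′ →
               AllBetween (Bridge M y₀ K) a c → AllBetween (Bridge M y₀ K′) a c
bridged-mono K≤K′ = allBetween-mono λ (bridge w edge) → bridge (inWindow-mono K≤K′ w) edge

connected-bridged : ∀ {M u v} y₀ → Connected M u v → ∃[ K ] AllBetween (Bridge M y₀ K) (proj₁ u) (proj₁ v)
connected-bridged y₀ here = 0 , allBetween-refl _
connected-bridged y₀ (there (adjN x y _) path) = connected-bridged y₀ path
connected-bridged y₀ (there (adjS x y _) path) = connected-bridged y₀ path
connected-bridged y₀ (there (adjE x y edge) path) with connected-bridged y₀ path | inWindow-exists y₀ y
... | K , rest | Ky , w =
  Ky ℕ.+ K , allBetween-trans (allBetween-adjacent (bridge (inWindow-mono (ℕP.m≤m+n Ky K) w) edge))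
                              (bridged-mono (ℕP.m≤n+m K Ky) rest)
connected-bridged y₀ (there (adjW x y edge) path) with connected-bridged y₀ path | inWindow-exists y₀ y
... | K , rest | Ky , w =
  Ky ℕ.+ K , allBetween-trans (allBetween-sym (allBetween-adjacent (bridge (inWindow-mono (ℕP.m≤m+n Ky K) w) edge)))
                              (bridged-mono (ℕP.m≤n+m K Ky) rest)

-- The algorithm

sweep : ℕ → List Dir
sweep K = replicate K S ++ replicate (K ℕ.+ K) N ++ replicate K S

toRow : ℕ → ℕ → List Dir
toRow K j = replicate K S ++ replicate j N

fromRow : ℕ → ℕ → List Dir
fromRow K j = replicate j S ++ replicate K N

try : ℕ → ℕ → List Dir
try K j = toRow K j ++ E ∷ fromRow K j ++ sweep K

tries : ℕ → ℕ → List Dir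
tries K zero    = []
tries K (suc j) = try K j ++ tries K j

round : ℕ → List Dir
round K = tries K (suc (K ℕ.+ K))

eastPhase : ℕ → ℕ → List Dir
eastPhase K n = sweep K ++ concat (replicate n (round K))

westPhase : ℕ → ℕ → List Dir
westPhase K n = map flip (eastPhase K n)

-- L is the number of instructions executed before the block; it bounds how far
-- the robot can be from its origin, hence how many rounds each phase needs.
eastRounds : ℕ → ℕ → ℕ
eastRounds K L = suc (L ℕ.+ K)

westRounds : ℕ → ℕ → ℕ
westRounds K L = suc (L ℕ.+ K ℕ.+ length (eastPhase K (eastRounds K L)))

block : ℕ → ℕ → List Dir
block K L = eastPhase K (eastRounds K L) ++ westPhase K (westRounds K L)

block-nonempty : ∀ K L → 0 ℕ.< length (block K L)
block-nonempty K L =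
  ++ˡ (eastPhase K (eastRounds K L)) (westPhase K (westRounds K L))
    (++ʳ (sweep K) (concat (replicate (eastRounds K L) (round K)))
      (++ˡ (round K) (concat (replicate (L ℕ.+ K) (round K)))
        (++ˡ (try K (K ℕ.+ K)) (tries K (K ℕ.+ K))
          (++ʳ (toRow K (K ℕ.+ K)) (E ∷ fromRow K (K ℕ.+ K) ++ sweep K) (s≤s z≤n)))))
  where
  ++ˡ : ∀ (xs ys : List Dir) → 0 ℕ.< length xs → 0 ℕ.< length (xs ++ ys)
  ++ˡ xs ys 0<xs = ℕP.<-≤-trans 0<xs (length-++-≤ˡ xs)
  ++ʳ : ∀ (xs ys : List Dir) → 0 ℕ.< length ys → 0 ℕ.< length (xs ++ ys)
  ++ʳ xs ys 0<ys = ℕP.<-≤-trans 0<ys (length-++-≤ʳ ys {xs})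

-- Boards with all vertical edges

module Vertical (M : Board) (vertical : ∀ x y → ver M x y ≡ true) where

  exec-north : ∀ n x y → exec M (x , y) (replicate n N) ≡ (x , y + + n)
  exec-north zero    x y = cong (x ,_) (sym (ℤP.+-identityʳ y))
  exec-north (suc n) x y rewrite vertical x y =
    trans (exec-north n x (y + 1ℤ)) (cong (x ,_) (ℤP.+-assoc y 1ℤ (+ n)))

  exec-south : ∀ n x y → exec M (x , y) (replicate n S) ≡ (x , y - + n)
  exec-south zero    x y = cong (x ,_) (sym (ℤP.+-identityʳ y))
  exec-south (suc n) x y rewrite vertical x (y - 1ℤ) =
    trans (exec-south n x (y - 1ℤ)) (cong (x ,_) (-1-n y (+ n)))
    where
    -1-n : ∀ y n → (y - 1ℤ) - n ≡ y - (1ℤ + n)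
    -1-n = solve-∀

  visits-north : ∀ {n j} x y → j ℕ.≤ n → Visits M (x , y + + j) (x , y) (replicate n N)
  visits-north {j = zero} x y _ = subst (λ t → Visits M (x , t) (x , y) _) (sym (ℤP.+-identityʳ y)) now
  visits-north {suc n} {suc j} x y (s≤s j≤n) =
    later (subst₂ (λ t p → Visits M (x , t) p _) (ℤP.+-assoc y 1ℤ (+ j)) (sym step-north)
                  (visits-north x (y + 1ℤ) j≤n))
    where
    step-north : step M (x , y) N ≡ (x , y + 1ℤ)
    step-north rewrite vertical x y = refl

  module Window (y₀ : ℤ) (K : ℕ) where

    sweep-returns : ∀ x → exec M (x , y₀) (sweep K) ≡ (x , y₀)
    sweep-returns x =
      exec-++ (replicate K S) (exec-south K x y₀)
        (exec-++ (replicate (K ℕ.+ K) N) (exec-north (K ℕ.+ K) x (y₀ - + K))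
          (trans (exec-south K x _) (cong (x ,_) (down-up-down y₀ (+ K)))))
      where
      down-up-down : ∀ y₀ k → ((y₀ - k) + (k + k)) - k ≡ y₀
      down-up-down = solve-∀

    sweep-visits : ∀ {x y} → InWindow y₀ K y → Visits M (x , y) (x , y₀) (sweep K)
    sweep-visits {x} (at-row j j≤2K refl) =
      visits-++ʳ (replicate K S) (exec-south K x y₀) (visits-++ˡ (replicate K S) (visits-north x _ j≤2K))

    exec-toRow : ∀ j x → exec M (x , y₀) (toRow K j) ≡ (x , row y₀ K j)
    exec-toRow j x = exec-++ (replicate K S) (exec-south K x y₀) (exec-north j x _)

    exec-fromRow : ∀ j x → exec M (x , row y₀ K j) (fromRow K j) ≡ (x , y₀)
    exec-fromRow j x =
      exec-++ (replicate j S) (exec-south j x _)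
        (trans (exec-north K x _) (cong (x ,_) (up-down y₀ (+ K) (+ j))))
      where
      up-down : ∀ y₀ k j → (((y₀ - k) + j) - j) + k ≡ y₀
      up-down = solve-∀

    module _ {j c c′} (east : step M (c , row y₀ K j) E ≡ (c′ , row y₀ K j)) where

      exec-try : exec M (c , y₀) (try K j) ≡ (c′ , y₀)
      exec-try = exec-++ (toRow K j) (exec-toRow j c)
        (trans (cong (λ p → exec M p (fromRow K j ++ sweep K)) east)
               (exec-++ (fromRow K j) (exec-fromRow j c′) (sweep-returns c′)))

      try-visits : ∀ {y} → InWindow y₀ K y → Visits M (c′ , y) (c , y₀) (try K j)
      try-visits w = visits-++ʳ (toRow K j) (exec-toRow j c)
        (later (subst (λ p → Visits M _ p _) (sym east)
          (visits-++ʳ (fromRow K j) (exec-fromRow j c′) (sweep-visits w))))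

    -- Columns entered are those in (c , end]; column c itself is swept by the caller.
    record Advance (ls : List Dir) (c : ℤ) : Set where
      field
        end     : ℤ
        exec≡   : exec M (c , y₀) ls ≡ (end , y₀)
        c≤end   : c ≤ end
        bridged : AllBetween (Bridge M y₀ K) c end
        visits  : ∀ {x y} → InWindow y₀ K y → c < x → x ≤ end → Visits M (x , y) (c , y₀) ls
    open Advance public

    stay : ∀ {ls c} → exec M (c , y₀) ls ≡ (c , y₀) → Advance ls c
    end     (stay {c = c} _) = c
    exec≡   (stay e)         = e
    c≤end   (stay _)         = ℤP.≤-refl
    bridged (stay {c = c} _) = allBetween-refl c
    visits  (stay _) _ c<x x≤c = ⊥-elim (ℤP.<⇒≱ c<x x≤c)

    cross : ∀ {ls c} → Bridge M y₀ K c → exec M (c , y₀) ls ≡ (c + 1ℤ , y₀) →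
            (∀ {y} → InWindow y₀ K y → Visits M (c + 1ℤ , y) (c , y₀) ls) → Advance ls c
    end     (cross {c = c} _ _ _) = c + 1ℤ
    exec≡   (cross _ e _)         = e
    c≤end   (cross {c = c} _ _ _) = ℤP.<⇒≤ (i<i+1 c)
    bridged (cross b _ _)         = allBetween-adjacent b
    visits  (cross {ls} {c} _ _ v) {x} w c<x x≤c+1 =
      subst (λ z → Visits M (z , _) (c , y₀) ls) (ℤP.≤-antisym (i<j⇒i+1≤j c<x) x≤c+1) (v w)

    advance-++ : ∀ {xs ys c} (a : Advance xs c) → Advance ys (end a) → Advance (xs ++ ys) c
    end     (advance-++ a b)      = end b
    exec≡   (advance-++ {xs} a b) = exec-++ xs (exec≡ a) (exec≡ b)
    c≤end   (advance-++ a b)      = ℤP.≤-trans (c≤end a) (c≤end b)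
    bridged (advance-++ a b)      = allBetween-trans (bridged a) (bridged b)
    visits  (advance-++ {xs} {ys} a b) {x} w c<x x≤end with x ℤP.≤? end a
    ... | yes x≤a = visits-++ˡ ys (visits a w c<x x≤a)
    ... | no  x≰a = visits-++ʳ xs (exec≡ a) (visits b w (ℤP.≰⇒> x≰a) x≤end)

    tries-advance : ∀ j c → j ℕ.≤ suc (K ℕ.+ K) →
                    Σ (Advance (tries K j) c) λ a → ∀ {i} → i ℕ.< j → hor M c (row y₀ K i) ≡ true → c < end a
    tries-advance zero    c _ = stay refl , λ ()
    tries-advance (suc j) c (s≤s j≤2K) with hor M c (row y₀ K j) in hor≡
    ... | true  = advance-++ first rest , λ _ _ → ℤP.<-≤-trans (i<i+1 c) (c≤end rest)
      where
      first : Advance (try K j) c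
      first = cross (bridge (at-row j j≤2K refl) hor≡)
                    (exec-try (step-east {M} hor≡)) (try-visits (step-east {M} hor≡))
      rest : Advance (tries K j) (c + 1ℤ)
      rest = proj₁ (tries-advance j (c + 1ℤ) (ℕP.m≤n⇒m≤1+n j≤2K))
    ... | false with tries-advance j c (ℕP.m≤n⇒m≤1+n j≤2K)
    ...   | rest , progress = advance-++ (stay (exec-try (step-east-blocked {M} hor≡))) rest , progress′
      where
      progress′ : ∀ {i} → i ℕ.< suc j → hor M c (row y₀ K i) ≡ true → c < end rest
      progress′ {i} i<1+j edge with ℕP.m<1+n⇒m<n∨m≡n i<1+j
      ... | inj₁ i<j  = progress i<j edge
      ... | inj₂ refl with trans (sym edge) hor≡
      ...   | ()

    round-advance : ∀ c → Σ (Advance (round K) c) λ a → Bridge M y₀ K c → c < end a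
    round-advance c with tries-advance (suc (K ℕ.+ K)) c ℕP.≤-refl
    ... | a , progress = a , λ { (bridge (at-row i i≤2K refl) edge) → progress (s≤s i≤2K) edge }

    rounds-advance : ∀ n c → Σ (Advance (concat (replicate n (round K))) c) λ a →
                     ∀ {t} → AllBetween (Bridge M y₀ K) c t → t ≤ c + + n → t ≤ end a
    rounds-advance zero    c = stay refl , λ _ t≤c+0 → subst (_ ≤_) (ℤP.+-identityʳ c) t≤c+0
    rounds-advance (suc n) c with round-advance c
    ... | first , progress with rounds-advance n (end first)
    ...   | rest , reaches = advance-++ first rest , reaches′
      where
      reaches′ : ∀ {t} → AllBetween (Bridge M y₀ K) c t → t ≤ c + + suc n → t ≤ end rest
      reaches′ {t} c⇝t t≤c+1+n with t ℤP.≤? end first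
      ... | yes t≤end = ℤP.≤-trans t≤end (c≤end rest)
      ... | no  t≰end = reaches (allBetween-trans (allBetween-sym (bridged first)) c⇝t) (begin
        t                     ≤⟨ t≤c+1+n ⟩
        c + (1ℤ + + n)        ≡⟨ ℤP.+-assoc c 1ℤ (+ n) ⟨
        (c + 1ℤ) + + n        ≤⟨ ℤP.+-monoˡ-≤ (+ n) (i<j⇒i+1≤j (progress (c⇝t c (inj₁ (ℤP.≤-refl , c<t))))) ⟩
        end first + + n       ∎)
        where
        open ℤP.≤-Reasoning
        c<t : c < t
        c<t = ℤP.≤-<-trans (c≤end first) (ℤP.≰⇒> t≰end)

    eastPhase-advance : ∀ n c → Advance (eastPhase K n) c
    eastPhase-advance n c = advance-++ (stay (sweep-returns c)) (proj₁ (rounds-advance n c))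

    eastPhase-visits : ∀ n {c x y} → InWindow y₀ K y → AllBetween (Bridge M y₀ K) c x →
                       c ≤ x → x ≤ c + + n → Visits M (x , y) (c , y₀) (eastPhase K n)
    eastPhase-visits n {c} {x} w c⇝x c≤x x≤c+n with x ℤP.≤? c
    ... | yes x≤c = subst (λ z → Visits M (z , _) (c , y₀) _) (ℤP.≤-antisym c≤x x≤c)
                          (visits-++ˡ _ (sweep-visits w))
    ... | no  x≰c = visits (eastPhase-advance n c) w (ℤP.≰⇒> x≰c) (proj₂ (rounds-advance n c) c⇝x x≤c+n)

neg-≤-+ : ∀ {a b} k → a ≤ b + k → - b ≤ - a + k
neg-≤-+ {a} {b} k a≤b+k =
  ℤP.≤-trans (ℤP.≤-reflexive (cancel b k)) (ℤP.+-monoˡ-≤ k (ℤP.neg-mono-≤ a≤b+k))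
  where
  cancel : ∀ b k → - b ≡ - (b + k) + k
  cancel = solve-∀

module West (M : Board) (vertical : ∀ x y → ver M x y ≡ true) (y₀ : ℤ) (K : ℕ) where

  private
    module East = Vertical.Window (mirror M) (λ x y → vertical (- x) y) y₀ K

  westPhase-end : ∀ n c →
                  ∃[ c′ ] exec M (c , y₀) (westPhase K n) ≡ (c′ , y₀) × AllBetween (Bridge M y₀ K) c c′
  westPhase-end n c =
    - East.end a ,
    trans (exec-mirror M (eastPhase K n) (c , y₀)) (cong reflect (East.exec≡ a)) ,
    subst (λ z → AllBetween (Bridge M y₀ K) z (- East.end a)) (ℤP.neg-involutive c)
          (allBetween-neg unmirror (East.bridged a))
    where
    a = East.eastPhase-advance n (- c)
    unmirror : ∀ {x} → Bridge (mirror M) y₀ K (- x - 1ℤ) → Bridge M y₀ K x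
    unmirror {x} (bridge w edge) = bridge w (subst (λ z → hor M z _ ≡ true) (-[-x-1]-1≡x x) edge)

  westPhase-visits : ∀ n {c x y} → InWindow y₀ K y → AllBetween (Bridge M y₀ K) c x →
                     x ≤ c → c ≤ x + + n → Visits M (x , y) (c , y₀) (westPhase K n)
  westPhase-visits n {c} {x} w c⇝x x≤c c≤x+n =
    subst₂ (λ p q → Visits M p q (westPhase K n)) (reflect-involutive _) (reflect-involutive _)
      (visits-mirror (East.eastPhase-visits n w (allBetween-neg (λ (bridge w edge) → bridge w edge) c⇝x)
                                             (ℤP.neg-mono-≤ x≤c) (neg-≤-+ (+ n) c≤x+n)))

module Blocks (M : Board) (vertical : ∀ x y → ver M x y ≡ true) (y₀ : ℤ) (K L : ℕ) where

  open Vertical.Window M vertical y₀ K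
  open West M vertical y₀ K

  east : ∀ c → Advance (eastPhase K (eastRounds K L)) c
  east = eastPhase-advance (eastRounds K L)

  block-end : ∀ c → ∃[ c′ ] exec M (c , y₀) (block K L) ≡ (c′ , y₀) × AllBetween (Bridge M y₀ K) c c′
  block-end c with westPhase-end (westRounds K L) (end (east c))
  ... | c′ , west≡ , west-bridged =
    c′ , exec-++ (eastPhase K (eastRounds K L)) (exec≡ (east c)) west≡ ,
    allBetween-trans (bridged (east c)) west-bridged

  block-visits : ∀ {c x y} → InWindow y₀ K y → AllBetween (Bridge M y₀ K) c x → Near c x (L ℕ.+ K) →
                 Visits M (x , y) (c , y₀) (block K L)
  block-visits {c} {x} w c⇝x near with c ℤP.≤? x
  ... | yes c≤x = visits-++ˡ (westPhase K (westRounds K L))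
        (eastPhase-visits (eastRounds K L) w c⇝x c≤x (proj₂ (near-mono (ℕP.n≤1+n _) near)))
  ... | no  c≰x = visits-++ʳ (eastPhase K (eastRounds K L)) (exec≡ (east c))
        (westPhase-visits (westRounds K L) w (allBetween-trans (allBetween-sym (bridged (east c))) c⇝x)
          (ℤP.≤-trans (ℤP.<⇒≤ (ℤP.≰⇒> c≰x)) (c≤end (east c)))
          (proj₂ (near-mono (ℕP.n≤1+n _) (near-trans (near-sym near) east-near))))
    where
    east-near : Near c (end (east c)) (length (eastPhase K (eastRounds K L)))
    east-near = subst (λ p → Near c (proj₁ p) _) (exec≡ (east c))
                      (exec-near M (eastPhase K (eastRounds K L)) (c , y₀))

open Concatenation (λ k xs → block k (length xs)) (λ k xs → block-nonempty k (length xs))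

prefix-end : ∀ {M} → (∀ x y → ver M x y ≡ true) → ∀ x₀ y₀ k →
             ∃[ c ] exec M (x₀ , y₀) (prefix k) ≡ (c , y₀) × AllBetween (Bridge M y₀ k) x₀ c
prefix-end vertical x₀ y₀ zero = x₀ , refl , allBetween-refl x₀
prefix-end {M} vertical x₀ y₀ (suc k) with prefix-end vertical x₀ y₀ k
... | c , prefix≡ , bridged with Blocks.block-end M vertical y₀ k (length (prefix k)) c
...   | c′ , block≡ , block-bridged =
  c′ , exec-++ (prefix k) prefix≡ block≡ , bridged-mono (ℕP.n≤1+n k) (allBetween-trans bridged block-bridged)

destination-visited : ∀ {M o d} → (∀ x y → ver M x y ≡ true) → Connected M o d →
                      ∃[ k ] Visits M d o (prefix k)
destination-visited {M} {x₀ , y₀} {xd , yd} vertical path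
  with connected-bridged y₀ path | near-exists x₀ xd | inWindow-exists y₀ yd
... | K₁ , x₀⇝xd | K₂ , x₀≈xd | K₃ , yd∈window with prefix-end vertical x₀ y₀ (K₁ ℕ.+ K₂ ℕ.+ K₃)
...   | c , prefix≡ , x₀⇝c =
  suc K , visits-++ʳ (prefix K) prefix≡
    (Blocks.block-visits M vertical y₀ K (length (prefix K))
      (inWindow-mono (ℕP.m≤n+m K₃ (K₁ ℕ.+ K₂)) yd∈window)
      (allBetween-trans (allBetween-sym x₀⇝c) (bridged-mono K₁≤K x₀⇝xd))
      (near-trans (near-sym x₀≈c) (near-mono K₂≤K x₀≈xd)))
  where
  K = K₁ ℕ.+ K₂ ℕ.+ K₃
  K₁≤K : K₁ ℕ.≤ K
  K₁≤K = ℕP.≤-trans (ℕP.m≤m+n K₁ K₂) (ℕP.m≤m+n _ K₃)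
  K₂≤K : K₂ ℕ.≤ K
  K₂≤K = ℕP.≤-trans (ℕP.m≤n+m K₂ K₁) (ℕP.m≤m+n _ K₃)
  x₀≈c : Near x₀ c (length (prefix K))
  x₀≈c = subst (λ p → Near x₀ (proj₁ p) _) prefix≡ (exec-near M (prefix K) (x₀ , y₀))

theorem3p1 : Σ Algorithm (λ A → (m : Maze) → InC m → Solves A m)
theorem3p1 = alg , λ m vertical →
  let k , visited = destination-visited vertical (conn m) in prefix-visits⇒solves k visited
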